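{- Let $G$ be a graph of order $n$ having $q\ge1$ vertices $v_1,\dots,v_q$, each of degree larger than two, such that the distance between any two of them is at least three, and such that the set of vertices of $G$ that are not adjacent to any $v_i$ (and are not among $v_1,\dots,v_q$) is an independent set. Then $$\gamma_{qtR}(G)\le n+3q-\sum_{i=1}^q (d_G(v_i)+1).$$
   Context: All graphs are finite, simple and undirected; $d_G(v)$ denotes the degree of $v$. For $f:V(G)\to\{0,1,2\}$ write $V_i=\{v:f(v)=i\}$, weight $\sum_v f(v)$. A quasi-total Roman dominating function (QTRDF) is a function $f:V(G)\to\{0,1,2\}$ such that every vertex $u$ with $f(u)=0$ is adjacent to some $v$ with $f(v)=2$, and every vertex $x$ that is isolated in the subgraph induced by $V_1\cup V_2$ satisfies $f(x)=1$. $\gamma_{qtR}(G)$ is the minimum weight of a QTRDF on $G$. -}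

module Defs where

open import Data.Nat using (ℕ; zero; suc; _+_; _*_; _≤_; _<_; _≥_; _>_)
open import Data.Fin using (Fin)
open import Data.Bool using (Bool; true; false)
open import Data.List using (List; length; filter; map; allFin)
open import Data.Nat.ListAction using (sum)
open import Data.Product using (Σ; ∃; _×_; _,_)
open import Relation.Binary.PropositionalEquality using (_≡_; _≢_)
open import Relation.Nullary using (¬_)
open import Data.Bool using (T?)

record Graph (n : ℕ) : Set where
  field
    adj     : Fin n → Fin n → Bool
    sym     : ∀ u v → adj u v ≡ adj v u
    irrefl  : ∀ v → adj v v ≡ false
open Graph public

Adj : ∀ {n} → Graph n → Fin n → Fin n → Set
Adj G u v = adj G u v ≡ true

degree : ∀ {n} → Graph n → Fin n → ℕ
degree {n} G v = length (filter (λ u → T? (adj G v u)) (allFin n))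

weight : ∀ {n} → (Fin n → ℕ) → ℕ
weight {n} f = sum (map f (allFin n))

record IsQTRDF {n} (G : Graph n) (f : Fin n → ℕ) : Set where
  field
    range    : ∀ v → f v ≤ 2
    dominate : ∀ u → f u ≡ 0 → ∃ λ v → Adj G u v × f v ≡ 2
    -- every x isolated in G[V₁ ∪ V₂] has f(x) = 1
    isolated : ∀ x → f x ≢ 0 → (∀ y → Adj G x y → f y ≡ 0) → f x ≡ 1

γqtR≤ : ∀ {n} → Graph n → ℕ → Set
γqtR≤ G k = ∃ λ f → IsQTRDF G f × weight f ≤ k

DistAtLeast3 : ∀ {n} → Graph n → Fin n → Fin n → Set
DistAtLeast3 G u w = u ≢ w × ¬ Adj G u w × (∀ x → Adj G u x → ¬ Adj G x w)

-- Put 2 on every v i, 1 on one chosen neighbour u i of v i, 0 on the other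
-- neighbours of v i, and 1 on every remaining vertex.  Distance at least three
-- makes the closed neighbourhoods N[v i] pairwise disjoint, so each N[v i]
-- (of size d(v i) + 1) carries weight 3 where it would otherwise carry
-- d(v i) + 1.  Formally this is a double count: for every vertex x,
-- f x + #{i : x ∈ N[v i]} ≤ 1 + Σᵢ (2·[x = v i] + [x = u i]).
module Submission where

open import Defs hiding (sym)
open import Data.Nat using (ℕ; _+_; _*_; _∸_; _≤_; _>_)
open import Data.Fin using (Fin)
open import Data.List using (map; allFin)
open import Data.Nat.ListAction using (sum)
open import Relation.Binary.PropositionalEquality using (_≡_; _≢_)
open import Relation.Nullary using (¬_)

open import Data.Nat using (zero; suc; _<_; z≤n; s≤s; z<s)
open import Data.Nat.Properties
  using (+-0-commutativeMonoid; +-*-semiring; +-mono-≤; m≤m+n; m≤n+m; ≤-trans; ≤-reflexive;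
         +-comm; +-identityʳ; *-comm; *-identityʳ; *-zeroʳ; m+n≤o⇒m≤o∸n; module ≤-Reasoning)
open import Data.Fin using (zero; suc; punchIn; _≟_)
open import Data.Fin.Properties using (punchInᵢ≢i; any?)
open import Data.Bool using (Bool; true; false; T?)
open import Data.Bool.Properties using () renaming (_≟_ to _≟ᵇ_)
open import Data.List using (tabulate; filter; length)
open import Data.Product using (∃; _,_; proj₁; proj₂)
open import Data.Empty using (⊥-elim)
open import Function using (_∘_; id)
open import Relation.Nullary using (yes; no; does)
open import Relation.Nullary.Decidable using (dec-true; dec-false)
open import Relation.Binary.PropositionalEquality using (refl; sym; trans; cong; cong₂; subst)
open import Algebra.Properties.CommutativeMonoid.Sum +-0-commutativeMonoid
  using (sum-syntax; sum-remove; ∑-distrib-+; ∑-comm; sum-cong-≗)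
  renaming (sum to ∑)
open import Algebra.Properties.Semiring.Sum +-*-semiring using (*-distribˡ-sum)

∑-const : ∀ m c → ∑[ i < m ] c ≡ m * c
∑-const zero    c = refl
∑-const (suc m) c = cong (c +_) (∑-const m c)

∑-mono-≤ : ∀ {m} {f g : Fin m → ℕ} → (∀ i → f i ≤ g i) → ∑ f ≤ ∑ g
∑-mono-≤ {zero}  f≤g = z≤n
∑-mono-≤ {suc m} f≤g = +-mono-≤ (f≤g zero) (∑-mono-≤ (f≤g ∘ suc))

term≤∑ : ∀ {m} (f : Fin m → ℕ) i → f i ≤ ∑ f
term≤∑ {suc m} f i = ≤-trans (m≤m+n (f i) _) (≤-reflexive (sym (sum-remove {i = i} f)))

∑-concentrated : ∀ {m} (f : Fin m → ℕ) i → (∀ j → j ≢ i → f j ≡ 0) → ∑ f ≡ f i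
∑-concentrated {suc m} f i vanish = begin
  ∑ f                              ≡⟨ sum-remove {i = i} f ⟩
  f i + ∑[ j < m ] f (punchIn i j) ≡⟨ cong (f i +_) (sum-cong-≗ (λ j → vanish _ (punchInᵢ≢i i j))) ⟩
  f i + ∑[ j < m ] 0               ≡⟨ cong (f i +_) (trans (∑-const m 0) (*-zeroʳ m)) ⟩
  f i + 0                          ≡⟨ +-identityʳ (f i) ⟩
  f i                              ∎
  where open Relation.Binary.PropositionalEquality.≡-Reasoning

∃-positive-term : ∀ {m} (f : Fin m → ℕ) → 0 < ∑ f → ∃ λ i → 0 < f i
∃-positive-term {suc m} f ∑f>0 with f zero in eq | ∑f>0
... | suc _ | _      = zero , subst (0 <_) (sym eq) z<s
... | zero  | ∑f′>0  with i , fᵢ>0 ← ∃-positive-term (f ∘ suc) ∑f′>0 = suc i , fᵢ>0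

∑-map-tabulate : ∀ {A : Set} {m} (f : A → ℕ) (g : Fin m → A) → sum (map f (tabulate g)) ≡ ∑ (f ∘ g)
∑-map-tabulate {m = zero}  f g = refl
∑-map-tabulate {m = suc m} f g = cong (f (g zero) +_) (∑-map-tabulate f (g ∘ suc))

𝟙 : Bool → ℕ
𝟙 true  = 1
𝟙 false = 0

𝟙-positive : ∀ {b} → 0 < 𝟙 b → b ≡ true
𝟙-positive {true} _ = refl

𝟙-≢true : ∀ {b} → b ≢ true → 𝟙 b ≡ 0
𝟙-≢true {false} _    = refl
𝟙-≢true {true}  b≢true = ⊥-elim (b≢true refl)

length-filter-tabulate : ∀ {A : Set} {m} (b : A → Bool) (g : Fin m → A) →
                         length (filter (λ a → T? (b a)) (tabulate g)) ≡ ∑[ i < m ] 𝟙 (b (g i))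
length-filter-tabulate {m = zero}  b g = refl
length-filter-tabulate {m = suc m} b g with b (g zero)
... | true  = cong suc (length-filter-tabulate b (g ∘ suc))
... | false = length-filter-tabulate b (g ∘ suc)

δ : ∀ {m} → Fin m → Fin m → ℕ
δ x y = 𝟙 (does (x ≟ y))

δ-refl : ∀ {m} (x : Fin m) → δ x x ≡ 1
δ-refl x = cong 𝟙 (dec-true (x ≟ x) refl)

δ-≢ : ∀ {m} {x y : Fin m} → x ≢ y → δ x y ≡ 0
δ-≢ {x = x} {y} x≢y = cong 𝟙 (dec-false (x ≟ y) x≢y)

∑-δ : ∀ {m} (y : Fin m) → ∑[ x < m ] δ x y ≡ 1
∑-δ y = trans (∑-concentrated (λ x → δ x y) y (λ x → δ-≢)) (δ-refl y)

module _ {n} (G : Graph n) where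

  Adj-sym : ∀ {x y} → Adj G x y → Adj G y x
  Adj-sym {x} {y} xy = trans (Graph.sym G y x) xy

  Adj-irrefl : ∀ x → ¬ Adj G x x
  Adj-irrefl x xx with () ← trans (sym (Graph.irrefl G x)) xx

  degree≡∑ : ∀ w → degree G w ≡ ∑[ x < n ] 𝟙 (adj G w x)
  degree≡∑ w = length-filter-tabulate (adj G w) id

  neighbour : ∀ w → 0 < degree G w → ∃ (Adj G w)
  neighbour w deg>0 with x , 𝟙>0 ← ∃-positive-term _ (subst (0 <_) (degree≡∑ w) deg>0) =
    x , 𝟙-positive 𝟙>0

  closedNbhd𝟙 : Fin n → Fin n → ℕ
  closedNbhd𝟙 w x = δ x w + 𝟙 (adj G w x)

  ∑-closedNbhd𝟙 : ∀ w → ∑[ x < n ] closedNbhd𝟙 w x ≡ 1 + degree G w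
  ∑-closedNbhd𝟙 w = trans (∑-distrib-+ (λ x → δ x w) _) (cong₂ _+_ (∑-δ w) (sym (degree≡∑ w)))

module Construction {n q} (G : Graph n) (v : Fin q → Fin n)
  (v-nonisolated : ∀ i → 0 < degree G (v i))
  (v-far : ∀ i j → i ≢ j → DistAtLeast3 G (v i) (v j)) where

  u : Fin q → Fin n
  u i = proj₁ (neighbour G (v i) (v-nonisolated i))

  v-adj-u : ∀ i → Adj G (v i) (u i)
  v-adj-u i = proj₂ (neighbour G (v i) (v-nonisolated i))

  v-injective : ∀ {i j} → v i ≡ v j → i ≡ j
  v-injective {i} {j} vᵢ≡vⱼ with i ≟ j
  ... | yes i≡j = i≡j
  ... | no  i≢j = ⊥-elim (proj₁ (v-far i j i≢j) vᵢ≡vⱼ)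

  neighbour-not-centre : ∀ {k x} → Adj G (v k) x → ∀ i → x ≢ v i
  neighbour-not-centre {k} {x} vₖx i refl with k ≟ i
  ... | yes refl = Adj-irrefl G (v k) vₖx
  ... | no  k≢i  = proj₁ (proj₂ (v-far k i k≢i)) vₖx

  no-common-neighbour : ∀ {i k x} → i ≢ k → Adj G (v k) x → ¬ Adj G (v i) x
  no-common-neighbour {i} {k} i≢k vₖx vᵢx = proj₂ (proj₂ (v-far k i (i≢k ∘ sym))) _ vₖx (Adj-sym G vᵢx)

  data Region (x : Fin n) : Set where
    centre   : ∀ k → x ≡ v k → Region x
    chosen   : ∀ k → x ≡ u k → Region x
    unchosen : ∀ k → Adj G (v k) x → (∀ i → x ≢ u i) → Region x
    outside  : (∀ i → x ≢ v i) → (∀ i → ¬ Adj G (v i) x) → Region x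

  region : ∀ x → Region x
  region x with any? (λ i → x ≟ v i)
  ... | yes (k , x≡vₖ) = centre k x≡vₖ
  ... | no  x∉v with any? (λ i → x ≟ u i)
  ...   | yes (k , x≡uₖ) = chosen k x≡uₖ
  ...   | no  x∉u with any? (λ i → adj G (v i) x ≟ᵇ true)
  ...     | yes (k , vₖx) = unchosen k vₖx (λ i x≡uᵢ → x∉u (i , x≡uᵢ))
  ...     | no  x∉N = outside (λ i x≡vᵢ → x∉v (i , x≡vᵢ)) (λ i vᵢx → x∉N (i , vᵢx))

  value : ∀ {x} → Region x → ℕ
  value (centre _ _)     = 2
  value (chosen _ _)     = 1
  value (unchosen _ _ _) = 0
  value (outside _ _)    = 1

  f : Fin n → ℕ
  f x = value (region x)

  f-centre : ∀ k → f (v k) ≡ 2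
  f-centre k with region (v k)
  ... | centre _ _         = refl
  ... | chosen j vₖ≡uⱼ     = ⊥-elim (neighbour-not-centre (v-adj-u j) k (sym vₖ≡uⱼ))
  ... | unchosen j vⱼvₖ _  = ⊥-elim (neighbour-not-centre vⱼvₖ k refl)
  ... | outside vₖ∉v _     = ⊥-elim (vₖ∉v k refl)

  f-chosen : ∀ k → f (u k) ≡ 1
  f-chosen k with region (u k)
  ... | centre j uₖ≡vⱼ   = ⊥-elim (neighbour-not-centre (v-adj-u k) j uₖ≡vⱼ)
  ... | chosen _ _       = refl
  ... | unchosen _ _ u∉u = ⊥-elim (u∉u k refl)
  ... | outside _ uₖ∉N   = ⊥-elim (uₖ∉N k (v-adj-u k))

  f-isQTRDF : IsQTRDF G f
  IsQTRDF.range f-isQTRDF x with region x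
  ... | centre _ _     = s≤s (s≤s z≤n)
  ... | chosen _ _     = s≤s z≤n
  ... | unchosen _ _ _ = z≤n
  ... | outside _ _    = s≤s z≤n
  IsQTRDF.dominate f-isQTRDF x fx≡0 with region x
  ... | unchosen k vₖx _ = v k , Adj-sym G vₖx , f-centre k
  IsQTRDF.isolated f-isQTRDF x fx≢0 isolated with region x
  ... | centre k refl  with () ← trans (sym (f-chosen k)) (isolated (u k) (v-adj-u k))
  ... | chosen _ _     = refl
  ... | unchosen _ _ _ = ⊥-elim (fx≢0 refl)
  ... | outside _ _    = refl

  coverage : Fin n → ℕ
  coverage x = ∑[ i < q ] closedNbhd𝟙 G (v i) x

  coverage-centre : ∀ k → coverage (v k) ≡ 1
  coverage-centre k =
    trans (∑-concentrated (λ i → closedNbhd𝟙 G (v i) (v k)) k other)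
          (cong₂ _+_ (δ-refl (v k)) (𝟙-≢true (Adj-irrefl G (v k))))
    where
    other : ∀ i → i ≢ k → closedNbhd𝟙 G (v i) (v k) ≡ 0
    other i i≢k = cong₂ _+_ (δ-≢ (i≢k ∘ sym ∘ v-injective))
                            (𝟙-≢true (proj₁ (proj₂ (v-far i k i≢k))))

  coverage-neighbour : ∀ {k x} → Adj G (v k) x → coverage x ≡ 1
  coverage-neighbour {k} {x} vₖx =
    trans (∑-concentrated (λ i → closedNbhd𝟙 G (v i) x) k other)
          (cong₂ _+_ (δ-≢ (neighbour-not-centre vₖx k)) (cong 𝟙 vₖx))
    where
    other : ∀ i → i ≢ k → closedNbhd𝟙 G (v i) x ≡ 0
    other i i≢k = cong₂ _+_ (δ-≢ (neighbour-not-centre vₖx i))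
                            (𝟙-≢true (no-common-neighbour i≢k vₖx))

  coverage-outside : ∀ {x} → (∀ i → x ≢ v i) → (∀ i → ¬ Adj G (v i) x) → coverage x ≡ 0
  coverage-outside x∉v x∉N = trans
    (sum-cong-≗ (λ i → cong₂ _+_ (δ-≢ (x∉v i)) (𝟙-≢true (x∉N i))))
    (trans (∑-const q 0) (*-zeroʳ q))

  charge : Fin q → Fin n → ℕ
  charge i x = 2 * δ x (v i) + δ x (u i)

  ∑-charge : ∀ i → ∑[ x < n ] charge i x ≡ 3
  ∑-charge i = trans (∑-distrib-+ (λ x → 2 * δ x (v i)) _)
                     (cong₂ _+_ (trans (sym (*-distribˡ-sum 2 (λ x → δ x (v i)))) (cong (2 *_) (∑-δ (v i))))
                                (∑-δ (u i)))

  charge-centre : ∀ k → 2 ≤ charge k (v k)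
  charge-centre k = ≤-trans (≤-reflexive (cong (2 *_) (sym (δ-refl (v k))))) (m≤m+n _ _)

  charge-chosen : ∀ k → 1 ≤ charge k (u k)
  charge-chosen k = ≤-trans (≤-reflexive (sym (δ-refl (u k)))) (m≤n+m _ _)

  value+coverage≤1+charge : ∀ x → f x + coverage x ≤ 1 + ∑[ i < q ] charge i x
  value+coverage≤1+charge x with region x
  ... | centre k refl rewrite coverage-centre k =
    s≤s (≤-trans (charge-centre k) (term≤∑ (λ i → charge i (v k)) k))
  ... | chosen k refl rewrite coverage-neighbour (v-adj-u k) =
    s≤s (≤-trans (charge-chosen k) (term≤∑ (λ i → charge i (u k)) k))
  ... | unchosen k vₖx _ rewrite coverage-neighbour vₖx = s≤s z≤n
  ... | outside x∉v x∉N rewrite coverage-outside x∉v x∉N = s≤s z≤n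

  ∑f+∑closedNbhd≤n+3q : ∑ f + ∑[ i < q ] (degree G (v i) + 1) ≤ n + 3 * q
  ∑f+∑closedNbhd≤n+3q = begin
    ∑ f + ∑[ i < q ] (degree G (v i) + 1)
      ≡⟨ cong (∑ f +_) (sum-cong-≗ (λ i → trans (+-comm _ 1) (sym (∑-closedNbhd𝟙 G (v i))))) ⟩
    ∑ f + ∑[ i < q ] ∑[ x < n ] closedNbhd𝟙 G (v i) x
      ≡⟨ cong (∑ f +_) (∑-comm (λ i x → closedNbhd𝟙 G (v i) x)) ⟩
    ∑ f + ∑ coverage
      ≡⟨ sym (∑-distrib-+ f coverage) ⟩
    ∑[ x < n ] (f x + coverage x)
      ≤⟨ ∑-mono-≤ value+coverage≤1+charge ⟩
    ∑[ x < n ] (1 + ∑[ i < q ] charge i x)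
      ≡⟨ ∑-distrib-+ {n} (λ _ → 1) _ ⟩
    ∑[ x < n ] 1 + ∑[ x < n ] ∑[ i < q ] charge i x
      ≡⟨ cong₂ _+_ (trans (∑-const n 1) (*-identityʳ n)) (∑-comm (λ x i → charge i x)) ⟩
    n + ∑[ i < q ] ∑[ x < n ] charge i x
      ≡⟨ cong (n +_) (trans (sum-cong-≗ ∑-charge) (trans (∑-const q 3) (*-comm q 3))) ⟩
    n + 3 * q
      ∎
    where open ≤-Reasoning

proposition2p5 : (n q : ℕ) → (G : Graph n) → (v : Fin q → Fin n) → 1 ≤ q
    → (∀ i → degree G (v i) > 2)
    → (∀ i j → i ≢ j → DistAtLeast3 G (v i) (v j))
    → (∀ x y → (∀ i → x ≢ v i) → (∀ i → ¬ Adj G x (v i))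
    → (∀ i → y ≢ v i) → (∀ i → ¬ Adj G y (v i)) → ¬ Adj G x y)
    → γqtR≤ G ((n + 3 * q) ∸ sum (map (λ i → degree G (v i) + 1) (allFin q)))
proposition2p5 n q G v _ deg>2 far _ =
  f , f-isQTRDF , m+n≤o⇒m≤o∸n (weight f) bound
  where
  open Construction G v (λ i → ≤-trans (s≤s z≤n) (deg>2 i)) far
  bound : weight f + sum (map (λ i → degree G (v i) + 1) (allFin q)) ≤ n + 3 * q
  bound rewrite ∑-map-tabulate f id | ∑-map-tabulate (λ i → degree G (v i) + 1) id = ∑f+∑closedNbhd≤n+3q
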